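{- Let $G$ be an edge-coloured graph and let $\mathcal{P}_1,\dots,\mathcal{P}_t$ and $\mathcal{P}'_1,\dots,\mathcal{P}'_t$ be two $(k,q)$-nice sequences of labelled paths such that the set of endpoints of $\mathcal{P}_1,\dots,\mathcal{P}_t$ equals the set of endpoints of $\mathcal{P}'_1,\dots,\mathcal{P}'_t$. If some vertex $v$ is an internal vertex of both $\mathcal{P}_i$ and $\mathcal{P}'_j$, then $\mathcal{P}_i$ and $\mathcal{P}'_j$ have the same endpoints.
   Context: A labelled path of length $k$ is a sequence of distinct vertices $v_0,\dots,v_k$ with consecutive ones adjacent; its endpoints are $v_0,v_k$ and the others are internal. A homomorphic copy $\phi$ of the cycle $C_{2k}$ (vertices $c_1,\dots,c_{2k}$ in cyclic order; $\phi$ maps edges to edges) extends the path if $\phi(c_{i+1})=v_i$ for $0\le i\le k$. A sequence of labelled paths $\mathcal{P}_1,\dots,\mathcal{P}_t$ is $(k,q)$-nice if: each $\mathcal{P}_i$ has $k$ edges; each colour appears at most once on the union of the paths; for $i<j$ the distance in $G$ between any vertex of $\mathcal{P}_i$ and any vertex of $\mathcal{P}_j$ is greater than $k-1$; and for every $i$ the number of homomorphic copies of $C_{2k}$ extending $\mathcal{P}_i$ is at most $q$. -}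

module Defs where

open import Level using (0ℓ)
open import Data.Nat using (ℕ; zero; suc; _+_; _<_; _≤_)
open import Data.Fin using (Fin; toℕ; inject₁; fromℕ) renaming (zero to fzero; suc to fsuc; _<_ to _<ᶠ_)
open import Data.Vec using (Vec; lookup)
open import Data.List using (List; length)
open import Data.List.Relation.Unary.All using (All)
open import Data.List.Relation.Unary.Unique.Propositional using (Unique)
open import Data.Product using (Σ; ∃; _×_; _,_)
open import Data.Sum using (_⊎_)
open import Relation.Nullary using (¬_)
open import Relation.Binary.PropositionalEquality using (_≡_)
open import Function.Definitions using (Injective)

-- A finite simple graph on vertex set Fin n with an edge-colouring
-- (colours from an arbitrary type C).  The colour function is given on
-- all ordered pairs; only its values on edges matter.
record ColGraph (n : ℕ) : Set₁ where
  field
    Adj      : Fin n → Fin n → Set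
    sym      : ∀ {u v} → Adj u v → Adj v u
    irrefl   : ∀ {u} → ¬ Adj u u
    Colour   : Set
    col      : Fin n → Fin n → Colour
    col-sym  : ∀ u v → col u v ≡ col v u
open ColGraph public

module _ {n : ℕ} (G : ColGraph n) where

  Walk : Fin n → Fin n → ℕ → Set
  Walk u w zero    = u ≡ w
  Walk u w (suc ℓ) = ∃ λ x → Adj G u x × Walk x w ℓ

  -- dist_G(u,w) > k - 1, i.e. dist_G(u,w) ≥ k (vacuous for k = 0;
  -- also satisfied when u,w lie in different components).
  DistGreaterPred : ℕ → Fin n → Fin n → Set
  DistGreaterPred k u w = ∀ ℓ → ℓ < k → ¬ Walk u w ℓ

  record LPath (k : ℕ) : Set where
    field
      vtx     : Fin (suc k) → Fin n
      distinct : Injective _≡_ _≡_ vtx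
      adjc    : ∀ (e : Fin k) → Adj G (vtx (inject₁ e)) (vtx (fsuc e))
  open LPath public

  IsEndpoint : ∀ {k} → LPath k → Fin n → Set
  IsEndpoint {k} P x = x ≡ vtx P fzero ⊎ x ≡ vtx P (fromℕ k)

  IsInternal : ∀ {k} → LPath k → Fin n → Set
  IsInternal {k} P v = ∃ λ (i : Fin (suc k)) → 0 < toℕ i × toℕ i < k × vtx P i ≡ v

  -- Cycle C_{2k}: vertices c_1,…,c_{2k} are indexed by Fin (k + k)
  -- (index m stands for c_{m+1}); a and b are consecutive in cyclic order.
  CycConsec : ∀ {m} → Fin m → Fin m → Set
  CycConsec {m} a b = toℕ b ≡ suc (toℕ a) ⊎ (suc (toℕ a) ≡ m × toℕ b ≡ 0)

  IsHomCycle : ∀ k → Vec (Fin n) (k + k) → Set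
  IsHomCycle k φ = ∀ a b → CycConsec a b → Adj G (lookup φ a) (lookup φ b)

  Extends : ∀ {k} → LPath k → Vec (Fin n) (k + k) → Set
  Extends {k} P φ = ∀ (i : Fin (suc k)) (m : Fin (k + k)) → toℕ m ≡ toℕ i → lookup φ m ≡ vtx P i

  ExtendingCopy : ∀ {k} → LPath k → Vec (Fin n) (k + k) → Set
  ExtendingCopy {k} P φ = IsHomCycle k φ × Extends P φ

  AtMostCopies : ∀ {k} → ℕ → LPath k → Set
  AtMostCopies q P = ∀ (L : List (Vec (Fin n) _)) → Unique L → All (ExtendingCopy P) L → length L ≤ q

  edgeL : ∀ {k} → LPath k → Fin k → Fin n
  edgeL P e = vtx P (inject₁ e)
  edgeR : ∀ {k} → LPath k → Fin k → Fin n
  edgeR P e = vtx P (fsuc e)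

  record Nice (k q t : ℕ) (P : Fin t → LPath k) : Set where
    field
      -- each colour appears at most once on the union of the paths:
      -- two edges of the union with the same colour are the same edge
      colours : ∀ i e j e' →
        col G (edgeL (P i) e) (edgeR (P i) e) ≡ col G (edgeL (P j) e') (edgeR (P j) e') →
        (edgeL (P i) e ≡ edgeL (P j) e' × edgeR (P i) e ≡ edgeR (P j) e')
        ⊎ (edgeL (P i) e ≡ edgeR (P j) e' × edgeR (P i) e ≡ edgeL (P j) e')
      far     : ∀ i j → i <ᶠ j → ∀ a b → DistGreaterPred k (vtx (P i) a) (vtx (P j) b)
      fewCopies : ∀ i → AtMostCopies q (P i)

-- An internal vertex v of a path of length k is joined to each endpoint of
-- that path by a walk of length less than k.  So if v is internal to both
-- P i and P' j, every endpoint x of P i is within distance k - 1 of v; since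
-- x is also an endpoint of some P' j', and distinct paths of a nice sequence
-- are at distance at least k, we get j' = j.  Exchanging the roles of the
-- two sequences gives the converse.
module Submission where

open import Defs
open import Data.Nat using (ℕ; zero; suc; _<_)
open import Data.Nat.Properties using (∸-monoʳ-<; <⇒≤)
open import Data.Fin using (Fin; toℕ; inject₁; opposite) renaming (zero to fzero; suc to fsuc)
open import Data.Fin.Properties using (<-cmp; opposite-prop; opposite-involutive)
open import Data.Product using (∃; _,_; _×_)
open import Data.Sum using (inj₁; inj₂)
open import Data.Empty using (⊥-elim)
open import Function using (_∘_)
open import Function.Bundles using (_⇔_; mk⇔; Equivalence)
open import Relation.Binary.Definitions using (tri<; tri≈; tri>)
open import Relation.Binary.PropositionalEquality using (_≡_; refl; cong; subst) renaming (sym to ≡-sym)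

opposite-inject₁ : ∀ {k} (e : Fin k) → opposite (inject₁ e) ≡ fsuc (opposite e)
opposite-inject₁ fzero    = refl
opposite-inject₁ (fsuc e) = cong inject₁ (opposite-inject₁ e)

module _ {n : ℕ} (G : ColGraph n) where

  Walk-snoc : ∀ {u w x} ℓ → Walk G u w ℓ → Adj G w x → Walk G u x (suc ℓ)
  Walk-snoc zero    refl          w~x = _ , w~x , refl
  Walk-snoc (suc ℓ) (y , u~y , W) w~x = y , u~y , Walk-snoc ℓ W w~x

  Walk-reverse : ∀ {u w} ℓ → Walk G u w ℓ → Walk G w u ℓ
  Walk-reverse zero    refl          = refl
  Walk-reverse (suc ℓ) (y , u~y , W) = Walk-snoc ℓ (Walk-reverse ℓ W) (ColGraph.sym G u~y)

  Chain : ∀ {k} → (Fin (suc k) → Fin n) → Set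
  Chain f = ∀ e → Adj G (f (inject₁ e)) (f (fsuc e))

  Chain-walk : ∀ {k} (f : Fin (suc k) → Fin n) → Chain f →
               ∀ i → Walk G (f fzero) (f i) (toℕ i)
  Chain-walk         f chain fzero    = refl
  Chain-walk {suc k} f chain (fsuc i) = _ , chain fzero , Chain-walk (f ∘ fsuc) (chain ∘ fsuc) i

  Chain-reverse : ∀ {k} (f : Fin (suc k) → Fin n) → Chain f → Chain (f ∘ opposite)
  Chain-reverse f chain e =
    subst (λ z → Adj G (f z) (f (inject₁ (opposite e))))
          (≡-sym (opposite-inject₁ e)) (ColGraph.sym G (chain (opposite e)))

  endpoint-near-internal : ∀ {k} (P : LPath G k) {v x} → IsInternal G P v →
    IsEndpoint G P x → ∃ λ ℓ → ℓ < k × Walk G x v ℓ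
  endpoint-near-internal P (i , _ , i<k , refl) (inj₁ refl) =
    toℕ i , i<k , Chain-walk (vtx P) (adjc P) i
  endpoint-near-internal {k} P (i , 0<i , i<k , refl) (inj₂ refl) =
    toℕ (opposite i) , opposite-i<k , subst (λ z → Walk G _ (vtx P z) (toℕ (opposite i)))
      (opposite-involutive i) (Chain-walk (vtx P ∘ opposite) (Chain-reverse (vtx P) (adjc P)) (opposite i))
    where
    opposite-i<k : toℕ (opposite i) < k
    opposite-i<k = subst (_< k) (≡-sym (opposite-prop i)) (∸-monoʳ-< 0<i (<⇒≤ i<k))

  endpoint-vertex : ∀ {k} (P : LPath G k) {x} → IsEndpoint G P x → ∃ λ a → vtx P a ≡ x
  endpoint-vertex P (inj₁ refl) = fzero , refl
  endpoint-vertex P (inj₂ refl) = _ , refl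

  Nice-close⇒same : ∀ {k q t} {P : Fin t → LPath G k} → Nice G k q t P →
    ∀ i j a b ℓ → ℓ < k → Walk G (vtx (P i) a) (vtx (P j) b) ℓ → i ≡ j
  Nice-close⇒same nice i j a b ℓ ℓ<k W with <-cmp i j
  ... | tri< i<j _ _ = ⊥-elim (Nice.far nice i j i<j a b ℓ ℓ<k W)
  ... | tri≈ _ i≡j _ = i≡j
  ... | tri> _ _ j<i = ⊥-elim (Nice.far nice j i j<i b a ℓ ℓ<k (Walk-reverse ℓ W))

  endpoint-transfer : ∀ {k q t} (P P' : Fin t → LPath G k) → Nice G k q t P' →
    (∀ x → (∃ λ i → IsEndpoint G (P i) x) → (∃ λ j → IsEndpoint G (P' j) x)) →
    ∀ i j {v} → IsInternal G (P i) v → IsInternal G (P' j) v →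
    ∀ x → IsEndpoint G (P i) x → IsEndpoint G (P' j) x
  endpoint-transfer P P' nice' ends i j v∈Pi (r , _ , _ , refl) x x∈∂Pi
    with endpoint-near-internal (P i) v∈Pi x∈∂Pi | ends x (i , x∈∂Pi)
  ... | ℓ , ℓ<k , W | j' , x∈∂P'j' with endpoint-vertex (P' j') x∈∂P'j'
  ... | a , refl with Nice-close⇒same nice' j' j a r ℓ ℓ<k W
  ... | refl = x∈∂P'j'

lemma3p10 : ∀ {n} (G : ColGraph n) (k q t : ℕ) (P P' : Fin t → LPath G k) →
    Nice G k q t P → Nice G k q t P' →
    (∀ x → (∃ λ i → IsEndpoint G (P i) x) ⇔ (∃ λ j → IsEndpoint G (P' j) x)) →
    ∀ i j v → IsInternal G (P i) v → IsInternal G (P' j) v →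
    ∀ x → IsEndpoint G (P i) x ⇔ IsEndpoint G (P' j) x
lemma3p10 G k q t P P' nice nice' sameEnds i j v v∈Pi v∈P'j x =
  mk⇔ (endpoint-transfer G P P' nice' (Equivalence.to ∘ sameEnds) i j v∈Pi v∈P'j x)
      (endpoint-transfer G P' P nice (Equivalence.from ∘ sameEnds) j i v∈P'j v∈Pi x)
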